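{- Let $G$ be a finite simple graph with vertices $v_1,\dots,v_n$ such that no vertex of $G$ is adjacent to all other vertices, and let $d$ be a positive integer. Let $G'$ be the graph with vertex set consisting of top vertices $t_1,\dots,t_d$, middle vertices $m_1,\dots,m_n$, and bottom vertices $b_{i,j}$ for $1\le i\le n$, $1\le j\le n+1$, whose edges are: all pairs of distinct top vertices; all pairs of distinct bottom vertices; all pairs $t_i m_j$; and $m_i b_{j,k}$ exactly when $i=j$ or $v_iv_j$ is an edge of $G$; there are no other edges. Let $h=n(n+1)+d$. Suppose $G'$ has Hadwiger number at least $h$, and let $S_1,\dots,S_h$ be pairwise disjoint vertex sets of $G'$, each inducing a connected subgraph, such that every two of them are joined by an edge of $G'$. For a top vertex $t_i$, let $S$ be the set among $S_1,\dots,S_h$ that contains $t_i$. Then $D=\{v_j \mid m_j\in S\}$ is a dominating set of $G$.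
   Context: A vertex $v$ dominates $w$ if $v=w$ or $vw$ is an edge; a dominating set of $G$ is a vertex set $D$ such that every vertex of $G$ is dominated by some member of $D$. The Hadwiger number of a graph is the largest $h$ such that $K_h$ is a minor of it, equivalently the largest number of pairwise disjoint connected vertex subsets that are pairwise joined by edges. -}

module Defs where

open import Data.Nat using (ℕ; suc)
open import Data.Fin using (Fin)
open import Data.Product using (Σ; ∃; _×_; _,_)
open import Data.Sum using (_⊎_)
open import Data.Unit using (⊤)
open import Data.Empty using (⊥)
open import Relation.Nullary using (¬_)
open import Relation.Binary.PropositionalEquality using (_≡_; _≢_)

record SimpleGraph (V : Set) : Set₁ where
  field
    Adj    : V → V → Set
    sym    : ∀ {x y} → Adj x y → Adj y x
    irrefl : ∀ {x} → ¬ Adj x x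
open SimpleGraph public

VSet : Set → Set₁
VSet V = V → Set

Dominates : ∀ {V} → SimpleGraph V → V → V → Set
Dominates G v w = v ≡ w ⊎ Adj G v w

Dominating : ∀ {V} → SimpleGraph V → VSet V → Set
Dominating {V} G D = ∀ (w : V) → Σ V λ v → D v × Dominates G v w

NoUniversalVertex : ∀ {V} → SimpleGraph V → Set
NoUniversalVertex {V} G = ∀ (v : V) → Σ V λ w → w ≢ v × ¬ Adj G v w

data WalkIn {V : Set} (G : SimpleGraph V) (S : VSet V) : V → V → Set where
  here : ∀ {x} → S x → WalkIn G S x x
  step : ∀ {x y z} → S x → Adj G x y → WalkIn G S y z → WalkIn G S x z

InducesConnected : ∀ {V} → SimpleGraph V → VSet V → Set
InducesConnected {V} G S =
  (Σ V S) × (∀ {x y} → S x → S y → WalkIn G S x y)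

-- Vertices of G': top t_i (i < d), middle m_j (j < n), bottom b_{i,j} (i < n, j < n+1).
data V' (n d : ℕ) : Set where
  top : Fin d → V' n d
  mid : Fin n → V' n d
  bot : Fin n → Fin (suc n) → V' n d

Adj' : ∀ {n} d → SimpleGraph (Fin n) → V' n d → V' n d → Set
Adj' d G (top i)   (top j)   = i ≢ j
Adj' d G (bot i k) (bot j l) = ¬ (i ≡ j × k ≡ l)
Adj' d G (top i)   (mid j)   = ⊤
Adj' d G (mid j)   (top i)   = ⊤
Adj' d G (mid i)   (bot j k) = i ≡ j ⊎ Adj G i j
Adj' d G (bot j k) (mid i)   = i ≡ j ⊎ Adj G i j
Adj' d G _         _         = ⊥

private
  open import Relation.Binary.PropositionalEquality using (refl) renaming (sym to ≡-sym)
  open import Data.Sum using (inj₁; inj₂)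

  adj'-sym : ∀ {n} d (G : SimpleGraph (Fin n)) {x y : V' n d} → Adj' d G x y → Adj' d G y x
  adj'-sym d G {top i}   {top j}   p q = p (≡-sym q)
  adj'-sym d G {bot i k} {bot j l} p (refl , refl) = p (refl , refl)
  adj'-sym d G {top i}   {mid j}   p = p
  adj'-sym d G {mid j}   {top i}   p = p
  adj'-sym d G {mid i}   {bot j k} p = p
  adj'-sym d G {bot j k} {mid i}   p = p

  adj'-irr : ∀ {n} d (G : SimpleGraph (Fin n)) {x : V' n d} → ¬ Adj' d G x x
  adj'-irr d G {top i}   p = p refl
  adj'-irr d G {mid i}   ()
  adj'-irr d G {bot i k} p = p (refl , refl)

G'-graph : ∀ {n} d → SimpleGraph (Fin n) → SimpleGraph (V' n d)
G'-graph d G = record { Adj = Adj' d G ; sym = adj'-sym d G ; irrefl = adj'-irr d G }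

module Submission where

-- The graph G' has exactly h + n vertices, of which exactly h are
-- not middle vertices, and the whole proof is counting against these numbers:
--
--  * (column lemma) for every column x, some branch set lies inside the column
--    {b_{x,1}, …, b_{x,n+1}}: otherwise one off-column vertex from each branch
--    set plus the n+1 column vertices are h+n+1 distinct vertices;
--  * every branch set contains a non-middle vertex (middle vertices are pairwise
--    non-adjacent, and a branch set consisting of middle vertices would, since G
--    has no universal vertex, violate the column lemma), hence each branch set
--    contains exactly one non-middle vertex;
--  * so the branch set S of t_i contains no bottom vertex.  For a vertex v_w of
--    G look at the edges from S to the other branch sets: each either joins some
--    m_j ∈ S to b_{w,c}, so that v_j dominates v_w, or ends outside column w in
--    the other set.  If the latter happened for every other set, column w would
--    capture no branch set, contradicting the column lemma.

open import Defs
open import Data.Nat using (ℕ; suc; _+_; _*_; _<_)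
open import Data.Fin using (Fin; zero; suc; join; splitAt; combine; remQuot; _≟_)
open import Data.Fin.Properties using (splitAt-join; join-splitAt; remQuot-combine; <⇒notInjective)
open import Data.Nat.Properties using (+-monoʳ-<; n<1+n)
open import Data.Product using (Σ; _×_; _,_; proj₁; proj₂; uncurry)
open import Data.Sum using (_⊎_; inj₁; inj₂; [_,_]′)
import Data.Sum as Sum
open import Data.Unit using (⊤; tt)
open import Data.Empty using (⊥; ⊥-elim)
open import Function using (_∘_; id)
open import Function.Definitions using (Injective)
open import Relation.Nullary using (¬_; yes; no)
open import Relation.Nullary.Decidable using (decidable-stable)
open import Relation.Binary.PropositionalEquality
  using (_≡_; _≢_; refl; trans; cong; subst) renaming (sym to ≡-sym)

finite-choice : ∀ {m} {A : Set} {B : Fin m → Set} →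
                (∀ l → A ⊎ B l) → A ⊎ (∀ l → B l)
finite-choice {ℕ.zero} f = inj₂ (λ ())
finite-choice {suc m} f with f zero | finite-choice (f ∘ suc)
... | inj₁ a | _      = inj₁ a
... | inj₂ _ | inj₁ a = inj₁ a
... | inj₂ b | inj₂ g = inj₂ λ { zero → b ; (suc l) → g l }

patch : ∀ {m} {P : Fin m → Set} (k : Fin m) → P k → (∀ l → l ≢ k → P l) → ∀ l → P l
patch k p f l with l ≟ k
... | yes refl = p
... | no l≢k   = f l l≢k

walk-leaves : ∀ {V} {G : SimpleGraph V} {T : VSet V} {x z} →
              WalkIn G T x z → z ≢ x → Σ V λ y → T y × Adj G x y
walk-leaves (here _)                   z≢x = ⊥-elim (z≢x refl)
walk-leaves (step _ x~y (here y∈))     _   = _ , y∈ , x~y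
walk-leaves (step _ x~y (step y∈ _ _)) _   = _ , y∈ , x~y

-- G' has exactly h + n vertices (h = n(n+1) + d): it is a retract of Fin (h + n),
-- so it contains no h + n + 1 distinct vertices.
module VertexCount (n d : ℕ) where
  h : ℕ
  h = n * suc n + d

  encode : V' n d → Fin (h + n)
  encode (top i)   = join h n (inj₁ (join (n * suc n) d (inj₂ i)))
  encode (mid j)   = join h n (inj₂ j)
  encode (bot j c) = join h n (inj₁ (join (n * suc n) d (inj₁ (combine j c))))

  decode : Fin (h + n) → V' n d
  decode = [ [ uncurry bot ∘ remQuot (suc n) , top ]′ ∘ splitAt (n * suc n) , mid ]′
         ∘ splitAt h

  decode-encode : ∀ v → decode (encode v) ≡ v
  decode-encode (top i)
    rewrite splitAt-join h n (inj₁ (join (n * suc n) d (inj₂ i)))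
          | splitAt-join (n * suc n) d (inj₂ {A = Fin (n * suc n)} i) = refl
  decode-encode (mid j) rewrite splitAt-join h n (inj₂ {A = Fin h} j) = refl
  decode-encode (bot j c)
    rewrite splitAt-join h n (inj₁ (join (n * suc n) d (inj₁ (combine j c))))
          | splitAt-join (n * suc n) d (inj₁ {B = Fin d} (combine j c))
          = cong (uncurry bot) (remQuot-combine {n} {suc n} j c)

  encode-injective : Injective _≡_ _≡_ encode
  encode-injective {u} {v} e =
    trans (≡-sym (decode-encode u)) (trans (cong decode e) (decode-encode v))

  splitAt-injective : Injective _≡_ _≡_ (splitAt h {suc n})
  splitAt-injective {a} {b} e =
    trans (≡-sym (join-splitAt h (suc n) a)) (trans (cong (join h (suc n)) e) (join-splitAt h (suc n) b))

  no-h+n+1-distinct-vertices : (F : Fin h ⊎ Fin (suc n) → V' n d) →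
                               Injective _≡_ _≡_ F → ⊥
  no-h+n+1-distinct-vertices F F-inj =
    <⇒notInjective {f = encode ∘ F ∘ splitAt h} (+-monoʳ-< h (n<1+n n))
      (splitAt-injective ∘ F-inj ∘ encode-injective)

NonMid : ∀ {n d} → V' n d → Set
NonMid (mid _) = ⊥
NonMid _       = ⊤

OffColumn : ∀ {n d} → Fin n → V' n d → Set
OffColumn x (bot j _) = j ≢ x
OffColumn x _         = ⊤

offColumn? : ∀ {n d} (x : Fin n) (v : V' n d) → OffColumn x v ⊎ Σ (Fin (suc n)) λ c → v ≡ bot x c
offColumn? x (top _)   = inj₁ tt
offColumn? x (mid _)   = inj₁ tt
offColumn? x (bot j c) with j ≟ x
... | yes refl = inj₂ (c , refl)
... | no j≢x   = inj₁ j≢x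

module MinorModel {n} (G : SimpleGraph (Fin n)) (d : ℕ)
  (S : Fin (n * suc n + d) → VSet (V' n d))
  (conn : ∀ k → InducesConnected (G'-graph d G) (S k))
  (disj : ∀ k l → k ≢ l → ∀ x → S k x → S l x → ⊥)
  (touch : ∀ k l → k ≢ l → Σ (V' n d) λ x → Σ (V' n d) λ y →
             S k x × S l y × Adj (G'-graph d G) x y) where

  open VertexCount n d using (h; no-h+n+1-distinct-vertices)

  G' : SimpleGraph (V' n d)
  G' = G'-graph d G

  V : Set
  V = V' n d

  NonMidIn : Fin h → Set
  NonMidIn l = Σ V λ y → S l y × NonMid y

  mid-neighbour-nonMid : ∀ {m y} → Adj G' (mid m) y → NonMid y
  mid-neighbour-nonMid {y = top _}   _ = tt
  mid-neighbour-nonMid {y = bot _ _} _ = tt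

  mid-neighbour-offColumn : ∀ {m x y} → x ≢ m → ¬ Adj G m x → Adj G' (mid m) y → OffColumn x y
  mid-neighbour-offColumn {y = top _}   _   _   _           = tt
  mid-neighbour-offColumn {y = bot _ _} x≢m _   (inj₁ refl) refl = x≢m refl
  mid-neighbour-offColumn {y = bot _ _} _   m≁x (inj₂ m~x)  refl = m≁x m~x

  top-neighbour-offColumn : ∀ {a x y} → Adj G' (top a) y → OffColumn x y
  top-neighbour-offColumn {y = top _} _ = tt
  top-neighbour-offColumn {y = mid _} _ = tt

  same-branch : ∀ {l l' u} → S l u → S l' u → l ≡ l'
  same-branch {l} {l'} {u} u∈l u∈l' = decidable-stable (l ≟ l') λ l≢l' → disj l l' l≢l' u u∈l u∈l'

  -- Representatives of the h branch sets together with n+1 further distinct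
  -- vertices, none a representative, would be h+n+1 distinct vertices.
  too-many-vertices : (r : Fin h → V) → (∀ l → S l (r l)) →
                      (g : Fin (suc n) → V) → Injective _≡_ _≡_ g →
                      (∀ l c → r l ≢ g c) → ⊥
  too-many-vertices r r∈ g g-inj r≢g = no-h+n+1-distinct-vertices [ r , g ]′ injective
    where
    injective : Injective _≡_ _≡_ [ r , g ]′
    injective {inj₁ l} {inj₁ l'} e = cong inj₁ (same-branch (r∈ l) (subst (S l') (≡-sym e) (r∈ l')))
    injective {inj₁ l} {inj₂ c}  e = ⊥-elim (r≢g l c e)
    injective {inj₂ c} {inj₁ l}  e = ⊥-elim (r≢g l c (≡-sym e))
    injective {inj₂ c} {inj₂ c'} e = cong inj₂ (g-inj e)

  column-captures-a-branch-set : (x : Fin n) → ¬ (∀ l → Σ V λ v → S l v × OffColumn x v)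
  column-captures-a-branch-set x rep =
    too-many-vertices (proj₁ ∘ rep) (proj₁ ∘ proj₂ ∘ rep) (bot x) (λ { refl → refl }) off
    where
    off : ∀ l c → proj₁ (rep l) ≢ bot x c
    off l c e = subst (OffColumn x) e (proj₂ (proj₂ (rep l))) refl

  -- A branch set holding m_m and another vertex holds a non-middle vertex, since
  -- a walk leaving m_m steps to a non-middle vertex.
  nonMid-beside-mid : ∀ {l m u} → S l (mid m) → S l u → u ≢ mid m → NonMidIn l
  nonMid-beside-mid {l} m∈ u∈ u≢m with walk-leaves (proj₂ (conn l) m∈ u∈) u≢m
  ... | y , y∈ , m~y = y , y∈ , mid-neighbour-nonMid m~y

  edge-from-mid-branch : ∀ {l m u z} → S l (mid m) → S l u → Adj G' u z →
                         NonMidIn l ⊎ Adj G' (mid m) z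
  edge-from-mid-branch {u = top a}   _  u∈ _ = inj₁ (top a , u∈ , tt)
  edge-from-mid-branch {u = bot a b} _  u∈ _ = inj₁ (bot a b , u∈ , tt)
  edge-from-mid-branch {m = m} {u = mid m'} m∈ u∈ u~z with m' ≟ m
  ... | yes refl = inj₂ u~z
  ... | no m'≢m  = inj₁ (nonMid-beside-mid m∈ u∈ λ { refl → m'≢m refl })

  -- Pick v_x ≠ v_m
  -- not adjacent to v_m: if no edge to another set revealed a non-middle vertex,
  -- every other set would contain a neighbour of m_m, which lies off column x,
  -- and so would this set (through m_m itself), contradicting the column lemma.
  mid-branch-has-nonMid : NoUniversalVertex G → ∀ {l m} → S l (mid m) → NonMidIn l
  mid-branch-has-nonMid nu {l} {m} m∈ with nu m
  ... | x , x≢m , m≁x =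
    [ id , ⊥-elim ∘ column-captures-a-branch-set x ]′
      (finite-choice (patch l (inj₂ (mid m , m∈ , tt)) across))
    where
    across : ∀ l' → l' ≢ l → NonMidIn l ⊎ Σ V λ v → S l' v × OffColumn x v
    across l' l'≢l =
      let (u , z , u∈ , z∈ , u~z) = touch l l' (l'≢l ∘ ≡-sym)
      in Sum.map₂ (λ m~z → z , z∈ , mid-neighbour-offColumn x≢m m≁x m~z)
                  (edge-from-mid-branch m∈ u∈ u~z)

  has-nonMid : NoUniversalVertex G → ∀ l → NonMidIn l
  has-nonMid nu l with proj₁ (conn l)
  ... | top a   , a∈ = top a , a∈ , tt
  ... | bot a b , b∈ = bot a b , b∈ , tt
  ... | mid m   , m∈ = mid-branch-has-nonMid nu m∈

  -- Each branch set contains at most one non-middle vertex: there are only h of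
  -- them, and every branch set has one.  Concretely, representatives of all sets
  -- (u for S_k), a second vertex v and the n middle vertices are too many.
  at-most-one-nonMid : NoUniversalVertex G → ∀ {k u v} → S k u → S k v →
                       NonMid u → NonMid v → u ≢ v → ⊥
  at-most-one-nonMid nu {k} {u} {v} u∈ v∈ nm-u nm-v u≢v =
    too-many-vertices (proj₁ ∘ rep) (proj₁ ∘ proj₂ ∘ rep) g g-injective apart
    where
    Rep : Fin h → Set
    Rep l = Σ V λ w → S l w × NonMid w × w ≢ v

    rep : ∀ l → Rep l
    rep = patch k (u , u∈ , nm-u , u≢v) λ l l≢k →
      let (w , w∈ , nm-w) = has-nonMid nu l
      in w , w∈ , nm-w , λ { refl → l≢k (same-branch w∈ v∈) }

    g : Fin (suc n) → V
    g zero    = v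
    g (suc m) = mid m

    g-injective : Injective _≡_ _≡_ g
    g-injective {zero}  {zero}  _    = refl
    g-injective {zero}  {suc _} refl = ⊥-elim nm-v
    g-injective {suc _} {zero}  refl = ⊥-elim nm-v
    g-injective {suc _} {suc _} refl = refl

    apart : ∀ l c → proj₁ (rep l) ≢ g c
    apart l zero    = proj₂ (proj₂ (proj₂ (rep l)))
    apart l (suc m) e = subst NonMid e (proj₁ (proj₂ (proj₂ (rep l))))

  Dominator : Fin h → Fin n → Set
  Dominator k w = Σ (Fin n) λ j → S k (mid j) × Dominates G j w

  -- An edge u z from the branch set of t_i to S_l either makes u a dominator of
  -- v_w or ends off column w (u is not a bottom vertex, as S_k already has t_i).
  edge-from-top-branch : NoUniversalVertex G → ∀ {i k l u z} (w : Fin n) →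
                         S k (top i) → S k u → S l z → Adj G' u z →
                         Dominator k w ⊎ Σ V λ v → S l v × OffColumn w v
  edge-from-top-branch nu {u = bot _ _} w t∈ u∈ _ _ = ⊥-elim (at-most-one-nonMid nu t∈ u∈ tt tt λ ())
  edge-from-top-branch nu {u = top _} {z} w t∈ u∈ z∈ u~z = inj₂ (z , z∈ , top-neighbour-offColumn u~z)
  edge-from-top-branch nu {u = mid j} {z} w t∈ u∈ z∈ u~z with offColumn? w z
  ... | inj₁ off        = inj₂ (z , z∈ , off)
  ... | inj₂ (c , refl) = inj₁ (j , u∈ , u~z)

  dominator-or-offColumn : NoUniversalVertex G → ∀ {i k} (w : Fin n) → S k (top i) →
                           ∀ l → l ≢ k → Dominator k w ⊎ Σ V λ v → S l v × OffColumn w v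
  dominator-or-offColumn nu {k = k} w t∈ l l≢k =
    let (u , z , u∈ , z∈ , u~z) = touch k l (l≢k ∘ ≡-sym)
    in edge-from-top-branch nu w t∈ u∈ z∈ u~z

-- To dominate v_w: each branch set S_l ≠ S_k yields a dominator of v_w or a vertex
-- off column w, and S_k has t_i off column w; by the column lemma the off-column
-- alternative cannot hold for every branch set.
lemma5 : ∀ {n} (G : SimpleGraph (Fin n)) → NoUniversalVertex G →
         ∀ d → 0 < d →
         (S : Fin (n * suc n + d) → VSet (V' n d)) →
         (∀ k → InducesConnected (G'-graph d G) (S k)) →
         (∀ k l → k ≢ l → ∀ x → S k x → S l x → ⊥) →
         (∀ k l → k ≢ l → Σ (V' n d) λ x → Σ (V' n d) λ y →
            S k x × S l y × Adj (G'-graph d G) x y) →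
         ∀ (i : Fin d) k → S k (top i) →
         Dominating G (λ j → S k (mid j))
lemma5 G nu d _ S conn disj touch i k t∈ w =
  [ id , ⊥-elim ∘ column-captures-a-branch-set w ]′
    (finite-choice (patch k (inj₂ (top i , t∈ , tt)) (dominator-or-offColumn nu w t∈)))
  where open MinorModel G d S conn disj touch
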